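{- For any $d$ and any $F\in\mathcal{F}(d)$, $|\mu(F)|\le(3d)!$.
   Context: A forest is good if no vertex is isolated and every internal (non-leaf) vertex has even degree at least $4$ (the empty forest is good). $\mathcal{F}(d)$ is the set of good forests with $d$ leaves, labelled bijectively by $[d]$. For $F\in\mathcal{F}(d)$ with set of internal vertices $V^\square$, $\mu(F):=\prod_{v\in V^\square}\big(-(\deg(v)-2)!\big)$, with $\mu(\emptyset)=1$. -}

module Defs where

open import Data.Bool using (Bool; true; false; if_then_else_)
open import Data.Nat using (ℕ; zero; suc; _+_; _*_; _∸_; _≤_; _!)
open import Data.Nat.Divisibility using (_∣_)
open import Data.Fin using (Fin; toℕ; _↑ˡ_; _↑ʳ_)
open import Data.Integer as ℤ using (ℤ; -_; +_)
open import Data.List using (List; map; allFin; foldr)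
open import Data.Nat.ListAction using (sum)
open import Data.Product using (Σ; _×_)
open import Data.Sum using (_⊎_)
open import Relation.Binary.PropositionalEquality using (_≡_)
open import Relation.Nullary using (¬_)
open import Function.Definitions using (Injective)

record Graph (n : ℕ) : Set where
  field
    adj    : Fin n → Fin n → Bool
    adj-sym : ∀ i j → adj i j ≡ adj j i
    adj-irrefl : ∀ i → adj i i ≡ false

open Graph public

deg : ∀ {n} → Graph n → Fin n → ℕ
deg {n} G v = sum (map (λ w → if adj G v w then 1 else 0) (allFin n))

HasCycle : ∀ {n} → Graph n → Set
HasCycle {n} G =
  Σ ℕ λ k → Σ (Fin (3 + k) → Fin n) λ c →
    Injective _≡_ _≡_ c ×
    (∀ i j → (toℕ j ≡ suc (toℕ i)) ⊎ (toℕ i ≡ 2 + k × toℕ j ≡ 0) →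
       adj G (c i) (c j) ≡ true)

IsForest : ∀ {n} → Graph n → Set
IsForest G = ¬ HasCycle G

Even : ℕ → Set
Even n = 2 ∣ n

-- A good forest with d leaves labelled bijectively by [d]: vertex set Fin (d + m),
-- the leaves (degree-1 vertices) are exactly the vertices i ↑ˡ m, i : Fin d
-- (leaf i carries label i); the remaining m vertices are the internal vertices,
-- each of even degree ≥ 4 (so in particular no vertex is isolated).
record GoodForest (d : ℕ) : Set where
  field
    m        : ℕ
    graph    : Graph (d + m)
    forest   : IsForest graph
    leaf-deg : ∀ (i : Fin d) → deg graph (i ↑ˡ m) ≡ 1
    int-deg  : ∀ (j : Fin m) → 4 ≤ deg graph (d ↑ʳ j) × Even (deg graph (d ↑ʳ j))

open GoodForest public

μ : ∀ {d} → GoodForest d → ℤ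
μ {d} F = foldr ℤ._*_ (+ 1)
  (map (λ j → - (+ ((deg (graph F) (d ↑ʳ j) ∸ 2) !))) (allFin (m F)))

module Submission where

open import Defs
open import Data.Nat using (ℕ; _≤_; _*_; _!)
open import Data.Integer using (∣_∣)

open import Data.Nat using (zero; suc; _+_; _∸_; _<_; z≤n; s≤s; s≤s⁻¹)
open import Data.Nat.Properties
open import Data.Nat.ListAction using (sum; product)
open import Data.Nat.Divisibility using (_∣_; ∣⇒≤)
open import Data.Nat.Combinatorics using (k![n∸k]!∣n!)
open import Data.Nat.Tactic.RingSolver using (solve-∀)
open import Data.Bool using (true; false; if_then_else_)
import Data.Bool.Properties as Bool
open import Data.Fin using (Fin; toℕ; fromℕ<; punchIn; _↑ˡ_; _↑ʳ_)
  renaming (zero to fzero; suc to fsuc)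
open import Data.Fin.Properties
  using ( toℕ<n; toℕ-fromℕ<; toℕ-injective; punchIn-injective; punchInᵢ≢i
        ; injective⇒≤; any?)
  renaming (_≟_ to _≟ᶠ_)
import Data.Integer as ℤ
import Data.Integer.Properties as ℤ
open import Data.List using ([]; _∷_; map; allFin; foldr; tabulate)
open import Data.List.Properties using (map-tabulate)
open import Data.Vec.Functional using (replicate)
open import Algebra.Properties.CommutativeMonoid.Sum +-0-commutativeMonoid
  using (sum-syntax; sum-remove; sum-cong-≗; sum-replicate-zero; ∑-distrib-+)
  renaming (sum to ∑)
open import Data.Product using (∃; _×_; _,_; proj₁)
open import Data.Sum using (_⊎_; inj₁; inj₂)
open import Data.Empty using (⊥-elim)
open import Relation.Binary.PropositionalEquality
open import Relation.Nullary using (¬_; Dec; yes; no; contradiction)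
open import Relation.Nullary.Decidable using (_×-dec_; ¬?)
open import Function using (_∘_)

-- Removing a leaf from a forest lowers the degree sum by at most 2, and a leaf always
-- exists (the first vertex of a path that cannot be extended), so the degrees of a forest
-- on n vertices sum to at most 2n. In a good forest the d leaves contribute d and each
-- internal vertex v contributes 2 + (deg v − 2), so the excesses deg v − 2 of the internal
-- vertices sum to at most d. Hence |μ(F)| = ∏ (deg v − 2)! ≤ (∑ (deg v − 2))! ≤ d! ≤ (3d)!.

sum-tabulate : ∀ {n} (f : Fin n → ℕ) → sum (tabulate f) ≡ ∑ f
sum-tabulate {zero}  f = refl
sum-tabulate {suc n} f = cong (f fzero +_) (sum-tabulate (f ∘ fsuc))

sum-map-allFin : ∀ {n} (f : Fin n → ℕ) → sum (map f (allFin n)) ≡ ∑ f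
sum-map-allFin f = trans (cong sum (map-tabulate (λ i → i) f)) (sum-tabulate f)

∑-const : ∀ n c → ∑[ i < n ] c ≡ n * c
∑-const zero    c = refl
∑-const (suc n) c = cong (c +_) (∑-const n c)

∑-↑ : ∀ m n (f : Fin (m + n) → ℕ) → ∑ f ≡ ∑[ i < m ] f (i ↑ˡ n) + ∑[ j < n ] f (m ↑ʳ j)
∑-↑ zero    n f = refl
∑-↑ (suc m) n f = trans (cong (f fzero +_) (∑-↑ m n (f ∘ fsuc))) (sym (+-assoc (f fzero) _ _))

∑-single≤1 : ∀ {n} (f : Fin n → ℕ) u → f u ≤ 1 → (∀ w → w ≢ u → f w ≡ 0) → ∑ f ≤ 1
∑-single≤1 {suc n} f u fu≤1 f≡0 = begin
  ∑ f                      ≡⟨ sum-remove {i = u} f ⟩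
  f u + ∑ (f ∘ punchIn u)  ≡⟨ cong (f u +_) ∑-rest≡0 ⟩
  f u + 0                  ≡⟨ +-identityʳ (f u) ⟩
  f u                      ≤⟨ fu≤1 ⟩
  1                        ∎
  where
  open ≤-Reasoning
  ∑-rest≡0 : ∑ (f ∘ punchIn u) ≡ 0
  ∑-rest≡0 = trans (sum-cong-≗ {y = replicate n 0} (λ w → f≡0 _ (punchInᵢ≢i u w)))
                   (sum-replicate-zero n)

!*!≤!+ : ∀ m n → m ! * n ! ≤ (m + n) !
!*!≤!+ m n = ∣⇒≤ {{(m + n) !≢0}}
  (subst (λ k → m ! * k ! ∣ (m + n) !) (m+n∸m≡n m n) (k![n∸k]!∣n! (m≤m+n m n)))

!-mono-≤ : ∀ {m n} → m ≤ n → m ! ≤ n !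
!-mono-≤ {m} {n} m≤n = begin
  m !                  ≤⟨ m≤m*n (m !) ((n ∸ m) !) {{(n ∸ m) !≢0}} ⟩
  m ! * (n ∸ m) !      ≤⟨ !*!≤!+ m (n ∸ m) ⟩
  (m + (n ∸ m)) !      ≡⟨ cong _! (m+[n∸m]≡n m≤n) ⟩
  n !                  ∎
  where open ≤-Reasoning

product-!≤!-sum : ∀ {A : Set} (f : A → ℕ) xs → product (map (λ x → f x !) xs) ≤ sum (map f xs) !
product-!≤!-sum f []       = ≤-refl
product-!≤!-sum f (x ∷ xs) = ≤-trans (*-monoʳ-≤ (f x !) (product-!≤!-sum f xs)) (!*!≤!+ (f x) _)

∣product-neg∣ : ∀ {A : Set} (f : A → ℕ) xs →
                ∣ foldr ℤ._*_ (ℤ.+ 1) (map (λ x → ℤ.- (ℤ.+ f x)) xs) ∣ ≡ product (map f xs)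
∣product-neg∣ f []       = refl
∣product-neg∣ f (x ∷ xs) = trans (ℤ.abs-* (ℤ.- (ℤ.+ f x)) _)
  (cong₂ _*_ (ℤ.∣-i∣≡∣i∣ (ℤ.+ f x)) (∣product-neg∣ f xs))

module _ {n : ℕ} (G : Graph n) where

  edge : Fin n → Fin n → ℕ
  edge v w = if adj G v w then 1 else 0

  edge-sym : ∀ v w → edge v w ≡ edge w v
  edge-sym v w = cong (if_then 1 else 0) (adj-sym G v w)

  edge-irrefl : ∀ v → edge v v ≡ 0
  edge-irrefl v = cong (if_then 1 else 0) (adj-irrefl G v)

  deg≡∑edge : ∀ v → deg G v ≡ ∑[ w < n ] edge v w
  deg≡∑edge v = sum-map-allFin (edge v)

  deg≤1 : ∀ {v} u → (∀ w → adj G v w ≡ true → w ≡ u) → deg G v ≤ 1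
  deg≤1 {v} u neighbour≡u = subst (_≤ 1) (sym (deg≡∑edge v))
    (∑-single≤1 (edge v) u (edge≤1 (adj G v u)) edge≡0)
    where
    edge≤1 : ∀ b → (if b then 1 else 0) ≤ 1
    edge≤1 true  = ≤-refl
    edge≤1 false = z≤n
    edge≡0 : ∀ w → w ≢ u → edge v w ≡ 0
    edge≡0 w w≢u with adj G v w in v~w
    ... | true  = contradiction (neighbour≡u w v~w) w≢u
    ... | false = refl

  ∑deg : ℕ
  ∑deg = ∑[ v < n ] deg G v

removeVertex : ∀ {n} → Graph (suc n) → Fin (suc n) → Graph n
removeVertex G v = record
  { adj        = λ i j → adj G (punchIn v i) (punchIn v j)
  ; adj-sym    = λ i j → adj-sym G (punchIn v i) (punchIn v j)
  ; adj-irrefl = λ i → adj-irrefl G (punchIn v i)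
  }

removeVertex-isForest : ∀ {n} (G : Graph (suc n)) v → IsForest G → IsForest (removeVertex G v)
removeVertex-isForest G v G-isForest (k , c , c-injective , c-adjacent) =
  G-isForest (k , punchIn v ∘ c , c-injective ∘ punchIn-injective v _ _ , c-adjacent)

module _ {n : ℕ} (G : Graph (suc n)) (v : Fin (suc n)) where

  private
    G-v : Graph n
    G-v = removeVertex G v

  deg-punchIn : ∀ u → deg G (punchIn v u) ≡ edge G (punchIn v u) v + deg G-v u
  deg-punchIn u = trans (deg≡∑edge G (punchIn v u))
    (trans (sum-remove {i = v} (edge G (punchIn v u)))
           (cong (edge G (punchIn v u) v +_) (sym (deg≡∑edge G-v u))))

  ∑edge-punchIn : ∑[ u < n ] edge G (punchIn v u) v ≡ deg G v
  ∑edge-punchIn = sym (begin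
    deg G v                                   ≡⟨ deg≡∑edge G v ⟩
    ∑[ w < suc n ] edge G v w                 ≡⟨ sum-remove {i = v} (edge G v) ⟩
    edge G v v + ∑-v                          ≡⟨ cong (_+ ∑-v) (edge-irrefl G v) ⟩
    ∑-v                                       ≡⟨ sum-cong-≗ (λ u → edge-sym G v (punchIn v u)) ⟩
    ∑[ u < n ] edge G (punchIn v u) v         ∎)
    where
    open ≡-Reasoning
    ∑-v : ℕ
    ∑-v = ∑[ u < n ] edge G v (punchIn v u)

  ∑deg-removeVertex : ∑deg G ≡ deg G v + (deg G v + ∑deg G-v)
  ∑deg-removeVertex = begin
    ∑deg G
      ≡⟨ sum-remove {i = v} (deg G) ⟩
    deg G v + ∑[ u < n ] deg G (punchIn v u)
      ≡⟨ cong (deg G v +_) (sum-cong-≗ deg-punchIn) ⟩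
    deg G v + ∑[ u < n ] (edge G (punchIn v u) v + deg G-v u)
      ≡⟨ cong (deg G v +_) (∑-distrib-+ (λ u → edge G (punchIn v u) v) (deg G-v)) ⟩
    deg G v + (∑[ u < n ] edge G (punchIn v u) v + ∑deg G-v)
      ≡⟨ cong (λ k → deg G v + (k + ∑deg G-v)) ∑edge-punchIn ⟩
    deg G v + (deg G v + ∑deg G-v)
      ∎
    where open ≡-Reasoning

module MaximalPath {N : ℕ} (G : Graph N) (G-isForest : IsForest G) where

  -- A path with L edges; vertex a for a > L is irrelevant.
  record Path (L : ℕ) : Set where
    field
      vertex    : ℕ → Fin N
      injective : ∀ {a c} → a ≤ L → c ≤ L → vertex a ≡ vertex c → a ≡ c
      adjacent  : ∀ {a} → a < L → adj G (vertex a) (vertex (suc a)) ≡ true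
  open Path

  toℕ≤ : ∀ {L} (i : Fin (suc L)) → toℕ i ≤ L
  toℕ≤ i = s≤s⁻¹ (toℕ<n i)

  length<N : ∀ {L} → Path L → L < N
  length<N {L} P = injective⇒≤ {f = λ (i : Fin (suc L)) → vertex P (toℕ i)}
    (λ {i} {j} eq → toℕ-injective (injective P (toℕ≤ i) (toℕ≤ j) eq))

  OnPath : ∀ {L} → Path L → Fin N → Set
  OnPath {L} P w = ∃ λ (i : Fin (suc L)) → vertex P (toℕ i) ≡ w

  onPath? : ∀ {L} (P : Path L) w → Dec (OnPath P w)
  onPath? P w = any? (λ i → vertex P (toℕ i) ≟ᶠ w)

  singleton : Fin N → Path 0
  singleton v = record
    { vertex    = λ _ → v
    ; injective = λ a≤0 c≤0 _ → trans (n≤0⇒n≡0 a≤0) (sym (n≤0⇒n≡0 c≤0))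
    ; adjacent  = λ ()
    }

  prepend : ∀ {L} (P : Path L) w → adj G (vertex P 0) w ≡ true → ¬ OnPath P w → Path (suc L)
  prepend {L} P w v~w w∉P =
    record { vertex = vertex′ ; injective = injective′ ; adjacent = adjacent′ }
    where
    vertex′ : ℕ → Fin N
    vertex′ zero    = w
    vertex′ (suc a) = vertex P a
    w≢vertex : ∀ {c} → c ≤ L → w ≢ vertex P c
    w≢vertex {c} c≤L eq =
      w∉P (fromℕ< (s≤s c≤L) , trans (cong (vertex P) (toℕ-fromℕ< (s≤s c≤L))) (sym eq))
    injective′ : ∀ {a c} → a ≤ suc L → c ≤ suc L → vertex′ a ≡ vertex′ c → a ≡ c
    injective′ {zero}  {zero}  _   _   _  = refl
    injective′ {zero}  {suc c} _   c≤  eq = ⊥-elim (w≢vertex (s≤s⁻¹ c≤) eq)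
    injective′ {suc a} {zero}  a≤  _   eq = ⊥-elim (w≢vertex (s≤s⁻¹ a≤) (sym eq))
    injective′ {suc a} {suc c} a≤  c≤  eq = cong suc (injective P (s≤s⁻¹ a≤) (s≤s⁻¹ c≤) eq)
    adjacent′ : ∀ {a} → a < suc L → adj G (vertex′ a) (vertex′ (suc a)) ≡ true
    adjacent′ {zero}  _   = trans (adj-sym G w (vertex P 0)) v~w
    adjacent′ {suc a} a<  = adjacent P (s≤s⁻¹ a<)

  no-chord : ∀ {L} (P : Path L) k → 2 + k ≤ L → adj G (vertex P (2 + k)) (vertex P 0) ≢ true
  no-chord {L} P k 2+k≤L closing = G-isForest (k , c , c-injective , c-adjacent)
    where
    c : Fin (3 + k) → Fin N
    c i = vertex P (toℕ i)
    c≤ : ∀ (i : Fin (3 + k)) → toℕ i ≤ L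
    c≤ i = ≤-trans (toℕ≤ i) 2+k≤L
    c-injective : ∀ {i j} → c i ≡ c j → i ≡ j
    c-injective {i} {j} eq = toℕ-injective (injective P (c≤ i) (c≤ j) eq)
    c-adjacent : ∀ i j → (toℕ j ≡ suc (toℕ i)) ⊎ (toℕ i ≡ 2 + k × toℕ j ≡ 0) →
                 adj G (c i) (c j) ≡ true
    c-adjacent i j (inj₁ j≡1+i)         rewrite j≡1+i = adjacent P (subst (_≤ L) j≡1+i (c≤ j))
    c-adjacent i j (inj₂ (i≡2+k , j≡0)) rewrite i≡2+k | j≡0 = closing

  closed-path⇒deg≤1 : ∀ {L} (P : Path L) → (∀ w → adj G (vertex P 0) w ≡ true → OnPath P w) →
                      deg G (vertex P 0) ≤ 1
  closed-path⇒deg≤1 {L} P closed = deg≤1 G (vertex P 1) neighbour≡vertex1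
    where
    v : Fin N
    v = vertex P 0
    neighbour≡vertex1 : ∀ w → adj G v w ≡ true → w ≡ vertex P 1
    neighbour≡vertex1 w v~w with closed w v~w
    ... | i , i↦w = from-position (toℕ i) (toℕ≤ i) i↦w
      where
      from-position : ∀ j → j ≤ L → vertex P j ≡ w → w ≡ vertex P 1
      from-position zero          _   j↦w = contradiction
        (trans (sym (adj-irrefl G v)) (subst (λ u → adj G v u ≡ true) (sym j↦w) v~w)) λ ()
      from-position (suc zero)    _   j↦w = sym j↦w
      from-position (suc (suc k)) j≤L j↦w = contradiction
        (trans (cong (λ u → adj G u v) j↦w) (trans (adj-sym G w v) v~w)) (no-chord P k j≤L)

  -- Prepend fresh neighbours of the first vertex while possible; since a path has fewer
  -- than N edges, N steps suffice to reach a path whose first vertex has no fresh neighbour.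
  extend : ∀ fuel {L} → N ≤ L + fuel → Path L → ∃ λ v → deg G v ≤ 1
  extend zero {L} N≤L P = contradiction (subst (N ≤_) (+-identityʳ L) N≤L) (<⇒≱ (length<N P))
  extend (suc fuel) {L} N≤L+1+fuel P
    with any? (λ w → (adj G (vertex P 0) w Bool.≟ true) ×-dec ¬? (onPath? P w))
  ... | yes (w , v~w , w∉P) =
    extend fuel (subst (N ≤_) (+-suc L fuel) N≤L+1+fuel) (prepend P w v~w w∉P)
  ... | no no-fresh         = vertex P 0 , closed-path⇒deg≤1 P closed
    where
    closed : ∀ w → adj G (vertex P 0) w ≡ true → OnPath P w
    closed w v~w with onPath? P w
    ... | yes w∈P = w∈P
    ... | no  w∉P = contradiction (w , v~w , w∉P) no-fresh

  ∃deg≤1 : Fin N → ∃ λ v → deg G v ≤ 1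
  ∃deg≤1 v = extend N ≤-refl (singleton v)

∑deg≤2n : ∀ {n} (G : Graph n) → IsForest G → ∑deg G ≤ 2 * n
∑deg≤2n {zero}  G _          = z≤n
∑deg≤2n {suc n} G G-isForest with MaximalPath.∃deg≤1 G G-isForest fzero
... | v , degv≤1 = begin
  ∑deg G                           ≡⟨ ∑deg-removeVertex G v ⟩
  deg G v + (deg G v + ∑deg G-v)   ≤⟨ +-mono-≤ degv≤1 (+-mono-≤ degv≤1 ∑deg-G-v≤2n) ⟩
  2 + 2 * n                        ≡⟨ *-suc 2 n ⟨
  2 * suc n                        ∎
  where
  open ≤-Reasoning
  G-v : Graph n
  G-v = removeVertex G v
  ∑deg-G-v≤2n : ∑deg G-v ≤ 2 * n
  ∑deg-G-v≤2n = ∑deg≤2n (removeVertex G v) (removeVertex-isForest G v G-isForest)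

excess : ∀ {d} (F : GoodForest d) → Fin (m F) → ℕ
excess {d} F j = deg (graph F) (d ↑ʳ j) ∸ 2

∑deg-goodForest : ∀ {d} (F : GoodForest d) →
                  ∑deg (graph F) ≡ d + (∑[ j < m F ] excess F j + m F * 2)
∑deg-goodForest {d} F = begin
  ∑deg G                                                  ≡⟨ ∑-↑ d M (deg G) ⟩
  ∑[ i < d ] deg G (i ↑ˡ M) + ∑[ j < M ] deg G (d ↑ʳ j)   ≡⟨ cong₂ _+_ ∑leaves ∑internal ⟩
  d + (∑[ j < M ] excess F j + M * 2)                     ∎
  where
  open ≡-Reasoning
  M : ℕ
  M = m F
  G : Graph (d + M)
  G = graph F
  ∑leaves : ∑[ i < d ] deg G (i ↑ˡ M) ≡ d
  ∑leaves = trans (sum-cong-≗ (leaf-deg F)) (trans (∑-const d 1) (*-identityʳ d))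
  deg≡excess+2 : ∀ j → deg G (d ↑ʳ j) ≡ excess F j + 2
  deg≡excess+2 j = sym (m∸n+n≡m (≤-trans (m≤n+m 2 2) (proj₁ (int-deg F j))))
  ∑internal : ∑[ j < M ] deg G (d ↑ʳ j) ≡ ∑[ j < M ] excess F j + M * 2
  ∑internal = trans (sum-cong-≗ deg≡excess+2)
    (trans (∑-distrib-+ (excess F) (λ _ → 2)) (cong (∑ (excess F) +_) (∑-const M 2)))

∑excess≤leaves : ∀ {d} (F : GoodForest d) → ∑[ j < m F ] excess F j ≤ d
∑excess≤leaves {d} F = +-cancelʳ-≤ (M * 2) _ d (+-cancelˡ-≤ d _ _ (begin
  d + (∑[ j < M ] excess F j + M * 2)   ≡⟨ ∑deg-goodForest F ⟨
  ∑deg (graph F)                        ≤⟨ ∑deg≤2n (graph F) (forest F) ⟩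
  2 * (d + M)                           ≡⟨ 2*[d+M]≡d+[d+M*2] d M ⟩
  d + (d + M * 2)                       ∎))
  where
  open ≤-Reasoning
  M : ℕ
  M = m F
  2*[d+M]≡d+[d+M*2] : ∀ d M → 2 * (d + M) ≡ d + (d + M * 2)
  2*[d+M]≡d+[d+M*2] = solve-∀

propositionC1 : ∀ (d : ℕ) (F : GoodForest d) → ∣ μ F ∣ ≤ (3 * d) !
propositionC1 d F = begin
  ∣ μ F ∣                                  ≡⟨ ∣product-neg∣ (λ j → excess F j !) (allFin (m F)) ⟩
  product (map (λ j → excess F j !) (allFin (m F)))
                                           ≤⟨ product-!≤!-sum (excess F) (allFin (m F)) ⟩
  sum (map (excess F) (allFin (m F))) !    ≡⟨ cong _! (sum-map-allFin (excess F)) ⟩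
  (∑[ j < m F ] excess F j) !              ≤⟨ !-mono-≤ (∑excess≤leaves F) ⟩
  d !                                      ≤⟨ !-mono-≤ (m≤n*m d 3) ⟩
  (3 * d) !                                ∎
  where open ≤-Reasoning
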